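{- Let $n\ge 1$ and let $d$ be an integer with $d\equiv 0\pmod 4$ and $d\neq 0$. Let $C$ be a binary self-dual $[4n+2,2n+1,d+2]$ code whose shadow has minimum weight $s\ge 3$. Then there exist two coordinates $i\neq j$ of $C$ such that the code $C'$ obtained from $C$ by subtraction of $(11)$ on coordinates $i,j$ is a binary self-dual $[4n,2n,d]$ code whose shadow has minimum weight $s-1$.
   Context: A binary code $C\subseteq GF(2)^m$ is self-dual if $C=C^\perp$ under the standard inner product. For a self-dual code $C$, let $C_0$ be its doubly-even subcode (codewords of weight divisible by $4$); the shadow of $C$ is $S=C_0^{\perp}\setminus C$, and the shadow weight (minimum weight of the shadow) is the minimum Hamming weight of a vector of $S$. Subtraction of $(11)$ on coordinates $i,j$: from $C$ keep exactly those codewords whose entries in positions $i$ and $j$ are equal (both $0$ or both $1$), and delete coordinates $i$ and $j$ from these codewords; the resulting set is the code $C'$ of length $m-2$. An $[m,k,d]$ code has length $m$, dimension $k$, minimum distance $d$. -}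

module Defs where

open import Data.Bool using (Bool; true; false; _∧_; _∨_; _xor_; not; if_then_else_)
open import Data.Nat using (ℕ; zero; suc; _+_; _≤_; _%_; _≡ᵇ_)
open import Data.List using (List; []; _∷_; map; _++_; foldr)
open import Data.Bool.ListAction using (all; any)
open import Data.Vec using (Vec; []; _∷_; lookup; removeAt; zipWith; replicate)
open import Data.Fin using (Fin; punchOut)
open import Data.Product using (Σ; _×_; _,_; ∃-syntax)
open import Relation.Binary.PropositionalEquality using (_≡_; _≢_)

-- Vectors of GF(2)^m, with GF(2) = Bool (false = 0, true = 1, addition = xor).
Word : ℕ → Set
Word m = Vec Bool m

allWords : (m : ℕ) → List (Word m)
allWords zero = [] ∷ []
allWords (suc m) = map (false ∷_) (allWords m) ++ map (true ∷_) (allWords m)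

Code : ℕ → Set
Code m = Word m → Bool

_∈ᶜ_ : ∀ {m} → Word m → Code m → Set
x ∈ᶜ C = C x ≡ true

wt : ∀ {m} → Word m → ℕ
wt [] = 0
wt (false ∷ xs) = wt xs
wt (true ∷ xs) = suc (wt xs)

_⊕_ : ∀ {m} → Word m → Word m → Word m
x ⊕ y = zipWith _xor_ x y

dist : ∀ {m} → Word m → Word m → ℕ
dist x y = wt (x ⊕ y)

dot : ∀ {m} → Word m → Word m → Bool
dot [] [] = false
dot (a ∷ xs) (b ∷ ys) = (a ∧ b) xor dot xs ys

eqW : ∀ {m} → Word m → Word m → Bool
eqW [] [] = true
eqW (a ∷ xs) (b ∷ ys) = (if a then b else not b) ∧ eqW xs ys

dual : ∀ {m} → Code m → Code m
dual {m} C x = all (λ y → not (C y) ∨ not (dot x y)) (allWords m)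

SelfDual : ∀ {m} → Code m → Set
SelfDual C = ∀ x → C x ≡ dual C x

card : ∀ {m} → Code m → ℕ
card {m} C = foldr (λ x acc → if C x then suc acc else acc) 0 (allWords m)

Linear : ∀ {m} → Code m → Set
Linear {m} C = (replicate m false ∈ᶜ C) × (∀ x y → x ∈ᶜ C → y ∈ᶜ C → (x ⊕ y) ∈ᶜ C)

MinDistance : ∀ {m} → Code m → ℕ → Set
MinDistance C d =
  (∃[ x ] ∃[ y ] (x ∈ᶜ C × y ∈ᶜ C × x ≢ y × dist x y ≡ d)) ×
  (∀ x y → x ∈ᶜ C → y ∈ᶜ C → x ≢ y → d ≤ dist x y)

pow2 : ℕ → ℕ
pow2 zero = 1
pow2 (suc k) = pow2 k + pow2 k

IsCode : ∀ {m} → Code m → ℕ → ℕ → Set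
IsCode C k d = Linear C × card C ≡ pow2 k × MinDistance C d

doublyEven : ∀ {m} → Code m → Code m
doublyEven C x = C x ∧ ((wt x % 4) ≡ᵇ 0)

shadow : ∀ {m} → Code m → Code m
shadow C x = dual (doublyEven C) x ∧ not (C x)

ShadowMinWeight : ∀ {m} → Code m → ℕ → Set
ShadowMinWeight C s =
  (∃[ x ] (x ∈ᶜ shadow C × wt x ≡ s)) × (∀ x → x ∈ᶜ shadow C → s ≤ wt x)

-- Subtraction of (11) on coordinates i ≠ j: keep the codewords with equal
-- entries at i and j, and delete coordinates i and j (removing i first, then
-- the position of j in the shortened word, which is punchOut i≢j).
subtract11 : ∀ {m} → Code (suc (suc m)) → (i j : Fin (suc (suc m))) → i ≢ j → Code m
subtract11 {m} C i j i≢j x =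
  any (λ c → C c ∧ eqW (lookup c i ∷ []) (lookup c j ∷ [])
               ∧ eqW (removeAt (removeAt c i) (punchOut i≢j)) x)
      (allWords (suc (suc m)))

module Submission where

-- Let c be a codeword of minimum weight d + 2 and u a shadow vector of minimum
-- weight s.  Since wt c ≡ 2 (mod 4), the shadow vector u is not orthogonal to c,
-- so u and c share a coordinate i; since u ⊕ c lies in the shadow as well,
-- minimality of s shows that c is not contained in the support of u, which gives
-- a coordinate j with c_j = 1 and u_j = 0.
--
-- The
-- central general result (module Subtraction) is that subtracting (11) on
-- coordinates i ≠ j from a self-dual code not containing the weight-2 word
-- supported on {i, j} gives a self-dual code of half the size.  For the
-- coordinates chosen above that word has weight 2 < d + 2, so the result
-- applies; deleting i, j from c gives a codeword of weight d, and from u a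
-- shadow vector of weight s - 1.  Conversely, nonzero codewords and shadow
-- vectors of the subtracted code lift to those of the original code, losing
-- weight at most 2, resp. exactly 1, which gives the lower bounds (module
-- Reduction).

open import Defs
open import Data.Nat using (ℕ; zero; suc; _*_; _+_; _∸_; _≤_; _%_; s≤s; z≤n)
open import Data.Nat.Properties
  using (suc-injective; +-suc; +-comm; +-identityʳ; *-suc; +-mono-≤; ≤-refl; ≤-trans; n≤0⇒n≡0;
         +-cancelˡ-≤; +-cancelʳ-≤; ∸-monoˡ-≤; *-cancelˡ-≡; ≡ᵇ⇒≡; +-commutativeSemigroup)
open import Data.Nat.DivMod using ([m+n]%n≡m%n; [m+kn]%n≡m%n; %-distribˡ-+)
open import Data.Nat.Tactic.RingSolver using (solve-∀)
open import Data.Bool using (Bool; true; false; _∧_; _∨_; _xor_; not; if_then_else_)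
open import Data.Bool.Properties
  using (∧-conicalˡ; ∧-conicalʳ; ∧-comm; ∧-idem; ∧-zeroʳ; ∧-identityʳ; ∧-distribʳ-xor; ∧-distribˡ-xor;
         ∨-zeroʳ; not-injective; not-¬; ¬-not; xor-same; xor-comm; xor-assoc;
         xor-identityˡ; xor-identityʳ; xor-∧-commutativeRing; T-≡)
open import Data.List using (List; []; _∷_; map; _++_; foldr)
open import Data.List.Properties using (foldr-++; foldr-map; foldr-fusion)
open import Data.List.Membership.Propositional using (_∈_; lose)
open import Data.List.Membership.Propositional.Properties using (∈-++⁺ˡ; ∈-++⁺ʳ; ∈-map⁺)
open import Data.List.Relation.Unary.Any using (here; satisfied)
open import Data.List.Relation.Unary.Any.Properties using (any⁺; any⁻)
open import Data.List.Relation.Unary.All as All using ()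
open import Data.List.Relation.Unary.All.Properties using (all⁺; all⁻)
open import Data.Bool.ListAction using (all; any)
open import Data.Vec using ([]; _∷_; lookup; removeAt; insertAt; zipWith; replicate; head)
open import Data.Vec.Properties
  using (lookup-zipWith; lookup-replicate; zipWith-comm; zipWith-assoc; zipWith-idem;
         zipWith-identityˡ; zipWith-identityʳ; removeAt-punchOut; removeAt-insertAt;
         insertAt-removeAt; insertAt-lookup; insertAt-punchIn)
open import Data.Fin using (Fin; punchOut) renaming (zero to fzero; suc to fsuc)
open import Data.Fin.Properties using (punchIn-punchOut)
open import Data.Product using (Σ; _×_; _,_; ∃-syntax; proj₁; proj₂)
open import Data.Sum using (_⊎_; inj₁; inj₂)
open import Data.Empty using (⊥; ⊥-elim)
open import Function using (_∘_)
open import Function.Bundles using (Equivalence)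
open import Algebra.Bundles using (CommutativeRing)
open import Algebra.Properties.CommutativeSemigroup
  (CommutativeRing.+-commutativeSemigroup xor-∧-commutativeRing)
  using () renaming (interchange to xor-interchange)
open import Algebra.Properties.CommutativeSemigroup +-commutativeSemigroup
  using () renaming (interchange to +-interchange)
open import Relation.Binary.PropositionalEquality

open Equivalence using (to; from)

bit : Bool → ℕ
bit false = 0
bit true = 1

bit≤1 : ∀ a → bit a ≤ 1
bit≤1 false = z≤n
bit≤1 true = s≤s z≤n

≡-by-true : ∀ {a b : Bool} → (a ≡ true → b ≡ true) → (b ≡ true → a ≡ true) → a ≡ b
≡-by-true {false} {false} _ _ = refl
≡-by-true {false} {true} _ b⇒a = b⇒a refl
≡-by-true {true} {false} a⇒b _ = sym (a⇒b refl)
≡-by-true {true} {true} _ _ = refl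

xor≡false⇒≡ : ∀ a b → a xor b ≡ false → a ≡ b
xor≡false⇒≡ false false _ = refl
xor≡false⇒≡ true true _ = refl

≡⇒xor≡false : ∀ {a b} → a ≡ b → a xor b ≡ false
≡⇒xor≡false {a} refl = xor-same a

eqW-sound : ∀ {m} (x y : Word m) → eqW x y ≡ true → x ≡ y
eqW-sound [] [] _ = refl
eqW-sound (a ∷ x) (b ∷ y) e =
  cong₂ _∷_ (head-sound a b (∧-conicalˡ _ _ e)) (eqW-sound x y (∧-conicalʳ _ _ e))
  where
  head-sound : ∀ a b → (if a then b else not b) ≡ true → a ≡ b
  head-sound false false _ = refl
  head-sound true true _ = refl

eqW-refl : ∀ {m} (x : Word m) → eqW x x ≡ true
eqW-refl [] = refl
eqW-refl (false ∷ x) = eqW-refl x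
eqW-refl (true ∷ x) = eqW-refl x

∈-allWords : ∀ {m} (x : Word m) → x ∈ allWords m
∈-allWords [] = here refl
∈-allWords {suc m} (false ∷ x) = ∈-++⁺ˡ (∈-map⁺ (false ∷_) (∈-allWords x))
∈-allWords {suc m} (true ∷ x) =
  ∈-++⁺ʳ (map (false ∷_) (allWords m)) (∈-map⁺ (true ∷_) (∈-allWords x))

any-intro : ∀ {A : Set} (f : A → Bool) {x l} → x ∈ l → f x ≡ true → any f l ≡ true
any-intro f x∈l fx = to T-≡ (any⁺ f (lose x∈l (from T-≡ fx)))

any-elim : ∀ {A : Set} (f : A → Bool) l → any f l ≡ true → ∃[ x ] f x ≡ true
any-elim f l e = let (x , fx) = satisfied (any⁻ f l (from T-≡ e)) in x , to T-≡ fx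

all-elim : ∀ {A : Set} (f : A → Bool) {x l} → all f l ≡ true → x ∈ l → f x ≡ true
all-elim f {l = l} e x∈l = to T-≡ (All.lookup (all⁺ f l (from T-≡ e)) x∈l)

all-intro : ∀ {A : Set} (f : A → Bool) l → (∀ x → f x ≡ true) → all f l ≡ true
all-intro f l h = to T-≡ (all⁻ f (All.universal (λ x → from T-≡ (h x)) l))

all-false : ∀ {A : Set} (f : A → Bool) l → all f l ≡ false → ∃[ x ] f x ≡ false
all-false f (y ∷ l) e with f y in fy
... | false = y , fy
... | true = all-false f l e

dual-elim : ∀ {m} (C : Code m) x {y} → x ∈ᶜ dual C → y ∈ᶜ C → dot x y ≡ false
dual-elim C x {y} x∈ y∈ =
  not-injective (subst (λ b → (not b ∨ not (dot x y)) ≡ true) y∈ (all-elim _ x∈ (∈-allWords y)))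

dual-intro : ∀ {m} (C : Code m) x → (∀ y → y ∈ᶜ C → dot x y ≡ false) → x ∈ᶜ dual C
dual-intro {m} C x h = all-intro _ (allWords m) orthogonal
  where
  orthogonal : ∀ y → (not (C y) ∨ not (dot x y)) ≡ true
  orthogonal y with C y in y∈
  ... | false = refl
  ... | true rewrite h y y∈ = refl

dual-witness : ∀ {m} (C : Code m) x → dual C x ≡ false → ∃[ y ] (y ∈ᶜ C × dot x y ≡ true)
dual-witness {m} C x e = let (y , fy) = all-false _ (allWords m) e in y , both (C y) (dot x y) fy
  where
  both : ∀ a b → (not a ∨ not b) ≡ false → a ≡ true × b ≡ true
  both true true _ = refl , refl

zeroW : ∀ m → Word m
zeroW m = replicate m false

_∧ʷ_ : ∀ {m} → Word m → Word m → Word m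
x ∧ʷ y = zipWith _∧_ x y

⊕-comm : ∀ {m} (x y : Word m) → x ⊕ y ≡ y ⊕ x
⊕-comm = zipWith-comm xor-comm

⊕-assoc : ∀ {m} (x y z : Word m) → (x ⊕ y) ⊕ z ≡ x ⊕ (y ⊕ z)
⊕-assoc = zipWith-assoc xor-assoc

⊕-identityˡ : ∀ {m} (x : Word m) → zeroW m ⊕ x ≡ x
⊕-identityˡ = zipWith-identityˡ xor-identityˡ

⊕-identityʳ : ∀ {m} (x : Word m) → x ⊕ zeroW m ≡ x
⊕-identityʳ = zipWith-identityʳ xor-identityʳ

⊕-self : ∀ {m} (x : Word m) → x ⊕ x ≡ zeroW m
⊕-self [] = refl
⊕-self (a ∷ x) = cong₂ _∷_ (xor-same a) (⊕-self x)

⊕-cancelˡ : ∀ {m} (x y : Word m) → x ⊕ (x ⊕ y) ≡ y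
⊕-cancelˡ x y = begin
  x ⊕ (x ⊕ y) ≡⟨ ⊕-assoc x x y ⟨
  (x ⊕ x) ⊕ y ≡⟨ cong (_⊕ y) (⊕-self x) ⟩
  zeroW _ ⊕ y ≡⟨ ⊕-identityˡ y ⟩
  y           ∎
  where open ≡-Reasoning

⊕≡zero⇒≡ : ∀ {m} (x y : Word m) → x ⊕ y ≡ zeroW m → x ≡ y
⊕≡zero⇒≡ x y e = begin
  x           ≡⟨ ⊕-cancelˡ y x ⟨
  y ⊕ (y ⊕ x) ≡⟨ cong (y ⊕_) (trans (⊕-comm y x) e) ⟩
  y ⊕ zeroW _ ≡⟨ ⊕-identityʳ y ⟩
  y           ∎
  where open ≡-Reasoning

lookup-⊕ : ∀ {m} (x y : Word m) k → lookup (x ⊕ y) k ≡ lookup x k xor lookup y k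
lookup-⊕ x y k = lookup-zipWith _xor_ k x y

wt-zero : ∀ m → wt (zeroW m) ≡ 0
wt-zero zero = refl
wt-zero (suc m) = wt-zero m

wt-⊕ : ∀ {m} (x y : Word m) → wt (x ⊕ y) + 2 * wt (x ∧ʷ y) ≡ wt x + wt y
wt-⊕ [] [] = refl
wt-⊕ (false ∷ x) (false ∷ y) = wt-⊕ x y
wt-⊕ (false ∷ x) (true ∷ y) = trans (cong suc (wt-⊕ x y)) (sym (+-suc (wt x) (wt y)))
wt-⊕ (true ∷ x) (false ∷ y) = cong suc (wt-⊕ x y)
wt-⊕ (true ∷ x) (true ∷ y) = begin
  wt (x ⊕ y) + 2 * suc (wt (x ∧ʷ y))      ≡⟨ two-more (wt (x ⊕ y)) (wt (x ∧ʷ y)) ⟩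
  suc (suc (wt (x ⊕ y) + 2 * wt (x ∧ʷ y))) ≡⟨ cong (suc ∘ suc) (wt-⊕ x y) ⟩
  suc (suc (wt x + wt y))                  ≡⟨ cong suc (+-suc (wt x) (wt y)) ⟨
  suc (wt x + suc (wt y))                  ∎
  where
  open ≡-Reasoning
  two-more : ∀ a w → a + 2 * suc w ≡ suc (suc (a + 2 * w))
  two-more = solve-∀

dot-comm : ∀ {m} (x y : Word m) → dot x y ≡ dot y x
dot-comm [] [] = refl
dot-comm (a ∷ x) (b ∷ y) = cong₂ _xor_ (∧-comm a b) (dot-comm x y)

dot-⊕ˡ : ∀ {m} (x y z : Word m) → dot (x ⊕ y) z ≡ dot x z xor dot y z
dot-⊕ˡ [] [] [] = refl
dot-⊕ˡ (a ∷ x) (b ∷ y) (c ∷ z) = begin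
  ((a xor b) ∧ c) xor dot (x ⊕ y) z               ≡⟨ cong₂ _xor_ (∧-distribʳ-xor c a b) (dot-⊕ˡ x y z) ⟩
  ((a ∧ c) xor (b ∧ c)) xor (dot x z xor dot y z) ≡⟨ xor-interchange (a ∧ c) (b ∧ c) (dot x z) (dot y z) ⟩
  ((a ∧ c) xor dot x z) xor ((b ∧ c) xor dot y z) ∎
  where open ≡-Reasoning

dot-⊕ʳ : ∀ {m} (x y z : Word m) → dot x (y ⊕ z) ≡ dot x y xor dot x z
dot-⊕ʳ x y z = begin
  dot x (y ⊕ z)         ≡⟨ dot-comm x (y ⊕ z) ⟩
  dot (y ⊕ z) x         ≡⟨ dot-⊕ˡ y z x ⟩
  dot y x xor dot z x   ≡⟨ cong₂ _xor_ (dot-comm y x) (dot-comm z x) ⟩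
  dot x y xor dot x z   ∎
  where open ≡-Reasoning

dot-zeroˡ : ∀ {m} (y : Word m) → dot (zeroW m) y ≡ false
dot-zeroˡ [] = refl
dot-zeroˡ (b ∷ y) = dot-zeroˡ y

overlap-parity : ∀ {m} (x y : Word m) → ∃[ k ] wt (x ∧ʷ y) ≡ bit (dot x y) + 2 * k
overlap-parity [] [] = 0 , refl
overlap-parity (false ∷ x) (b ∷ y) = overlap-parity x y
overlap-parity (true ∷ x) (false ∷ y) = overlap-parity x y
overlap-parity (true ∷ x) (true ∷ y) with dot x y | overlap-parity x y
... | false | k , e = k , cong suc e
... | true | k , e = suc k , trans (cong suc e) (sym (*-suc 2 k))

common-one : ∀ {m} (x y : Word m) → dot x y ≡ true → ∃[ k ] (lookup x k ≡ true × lookup y k ≡ true)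
common-one [] [] ()
common-one (true ∷ x) (true ∷ y) _ = fzero , refl , refl
common-one (false ∷ x) (b ∷ y) e = let (k , xk , yk) = common-one x y e in fsuc k , xk , yk
common-one (true ∷ x) (false ∷ y) e = let (k , xk , yk) = common-one x y e in fsuc k , xk , yk

outside-or-contained : ∀ {m} (u c : Word m) →
  (∃[ k ] (lookup c k ≡ true × lookup u k ≡ false)) ⊎ (wt (u ⊕ c) + wt c ≡ wt u)
outside-or-contained [] [] = inj₂ refl
outside-or-contained (a ∷ u) (b ∷ c) = extend a b (outside-or-contained u c)
  where
  extend : ∀ a b → (∃[ k ] (lookup c k ≡ true × lookup u k ≡ false)) ⊎ (wt (u ⊕ c) + wt c ≡ wt u) →
           (∃[ k ] (lookup (b ∷ c) k ≡ true × lookup (a ∷ u) k ≡ false)) ⊎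
           (wt ((a ∷ u) ⊕ (b ∷ c)) + wt (b ∷ c) ≡ wt (a ∷ u))
  extend false true _ = inj₁ (fzero , refl , refl)
  extend a b (inj₁ (k , ck , uk)) = inj₁ (fsuc k , ck , uk)
  extend false false (inj₂ e) = inj₂ e
  extend true false (inj₂ e) = inj₂ (cong suc e)
  extend true true (inj₂ e) = inj₂ (trans (+-suc (wt (u ⊕ c)) (wt c)) (cong suc e))

-- Weights modulo 4

double-mod4 : ∀ k → (2 * k) % 4 ≡ 0 ⊎ (2 * k) % 4 ≡ 2
double-mod4 zero = inj₁ refl
double-mod4 (suc zero) = inj₂ refl
double-mod4 (suc (suc k)) = subst (λ r → r ≡ 0 ⊎ r ≡ 2) (sym same-class) (double-mod4 k)
  where
  shift : ∀ k → 2 * suc (suc k) ≡ 2 * k + 4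
  shift = solve-∀
  same-class : (2 * suc (suc k)) % 4 ≡ (2 * k) % 4
  same-class = trans (cong (_% 4) (shift k)) ([m+n]%n≡m%n (2 * k) 4)

plus2-mod4 : ∀ w → w % 4 ≡ 0 → (2 + w) % 4 ≡ 2
plus2-mod4 w e = trans (%-distribˡ-+ 2 w 4) (cong (λ r → (2 + r) % 4) e)

plus2-mod4ʳ : ∀ w → w % 4 ≡ 0 → (w + 2) % 4 ≡ 2
plus2-mod4ʳ w e = trans (cong (_% 4) (+-comm w 2)) (plus2-mod4 w e)

sum-of-2s-mod4 : ∀ a b → a % 4 ≡ 2 → b % 4 ≡ 2 → (a + b) % 4 ≡ 0
sum-of-2s-mod4 a b ea eb = trans (%-distribˡ-+ a b 4) (cong₂ (λ r t → (r + t) % 4) ea eb)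

orthogonal-sum-mod4 : ∀ {m} (x y : Word m) → dot x y ≡ false →
  wt x % 4 ≡ 2 → wt y % 4 ≡ 2 → wt (x ⊕ y) % 4 ≡ 0
orthogonal-sum-mod4 x y x⊥y ex ey = begin
  wt (x ⊕ y) % 4                       ≡⟨ [m+kn]%n≡m%n (wt (x ⊕ y)) k 4 ⟨
  (wt (x ⊕ y) + k * 4) % 4             ≡⟨ cong (λ t → (wt (x ⊕ y) + t) % 4) overlap-weight ⟨
  (wt (x ⊕ y) + 2 * wt (x ∧ʷ y)) % 4   ≡⟨ cong (_% 4) (wt-⊕ x y) ⟩
  (wt x + wt y) % 4                    ≡⟨ sum-of-2s-mod4 (wt x) (wt y) ex ey ⟩
  0                                    ∎
  where
  open ≡-Reasoning
  k : ℕ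
  k = proj₁ (overlap-parity x y)
  quadruple : ∀ k → 2 * (2 * k) ≡ k * 4
  quadruple = solve-∀
  overlap-weight : 2 * wt (x ∧ʷ y) ≡ k * 4
  overlap-weight = trans (cong (λ w → 2 * w) (trans (proj₂ (overlap-parity x y)) (cong (λ b → bit b + 2 * k) x⊥y)))
                  (quadruple k)

-- Counting words

count : ∀ m → (Word m → Bool) → ℕ
count zero P = if P [] then 1 else 0
count (suc m) P = count m (P ∘ (false ∷_)) + count m (P ∘ (true ∷_))

tally : ∀ {m} → Code m → Word m → ℕ → ℕ
tally P x acc = if P x then suc acc else acc

card≡count : ∀ {m} (P : Code m) → card P ≡ count m P
card≡count {zero} P = refl
card≡count {suc m} P = begin
  foldr (tally P) 0 (zeros ++ ones)                ≡⟨ foldr-++ (tally P) 0 zeros ones ⟩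
  foldr (tally P) (foldr (tally P) 0 ones) zeros   ≡⟨ accumulate (foldr (tally P) 0 ones) zeros ⟨
  foldr (tally P) 0 zeros + foldr (tally P) 0 ones ≡⟨ cong₂ _+_ (foldr-map (tally P) (false ∷_) 0 (allWords m))
                                                               (foldr-map (tally P) (true ∷_) 0 (allWords m)) ⟩
  card (P ∘ (false ∷_)) + card (P ∘ (true ∷_))     ≡⟨ cong₂ _+_ (card≡count (P ∘ (false ∷_)))
                                                               (card≡count (P ∘ (true ∷_))) ⟩
  count (suc m) P                                  ∎
  where
  open ≡-Reasoning
  zeros ones : List (Word (suc m))
  zeros = map (false ∷_) (allWords m)
  ones = map (true ∷_) (allWords m)
  accumulate : ∀ k l → foldr (tally P) 0 l + k ≡ foldr (tally P) k l
  accumulate k = foldr-fusion (_+ k) 0 fuse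
    where
    fuse : ∀ x n → tally P x n + k ≡ tally P x (n + k)
    fuse x n with P x
    ... | true = refl
    ... | false = refl

count-cong : ∀ m {P Q : Word m → Bool} → (∀ x → P x ≡ Q x) → count m P ≡ count m Q
count-cong zero h rewrite h [] = refl
count-cong (suc m) h = cong₂ _+_ (count-cong m (h ∘ (false ∷_))) (count-cong m (h ∘ (true ∷_)))

count-none : ∀ m (P : Word m → Bool) → (∀ x → P x ≡ false) → count m P ≡ 0
count-none zero P h rewrite h [] = refl
count-none (suc m) P h =
  cong₂ _+_ (count-none m _ (h ∘ (false ∷_))) (count-none m _ (h ∘ (true ∷_)))

count-split : ∀ m (P Q : Word m → Bool) →
  count m P ≡ count m (λ x → P x ∧ Q x) + count m (λ x → P x ∧ not (Q x))
count-split zero P Q with P [] | Q []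
... | true | true = refl
... | true | false = refl
... | false | _ = refl
count-split (suc m) P Q = trans
  (cong₂ _+_ (count-split m (P ∘ (false ∷_)) (Q ∘ (false ∷_)))
             (count-split m (P ∘ (true ∷_)) (Q ∘ (true ∷_))))
  (+-interchange (withQ false) (withoutQ false) (withQ true) (withoutQ true))
  where
  withQ withoutQ : Bool → ℕ
  withQ a = count m (λ x → P (a ∷ x) ∧ Q (a ∷ x))
  withoutQ a = count m (λ x → P (a ∷ x) ∧ not (Q (a ∷ x)))

count-∨ : ∀ m (P Q : Word m → Bool) → (∀ x → P x ∧ Q x ≡ false) →
  count m (λ x → P x ∨ Q x) ≡ count m P + count m Q
count-∨ m P Q disjoint = trans (count-split m (λ x → P x ∨ Q x) P)
  (cong₂ _+_ (count-cong m (λ x → left (P x) (Q x))) (count-cong m (λ x → right (P x) (Q x) (disjoint x))))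
  where
  left : ∀ a b → ((a ∨ b) ∧ a) ≡ a
  left true b = refl
  left false b = ∧-zeroʳ b
  right : ∀ a b → a ∧ b ≡ false → ((a ∨ b) ∧ not a) ≡ b
  right true false _ = refl
  right false b _ = ∧-identityʳ b

count-translate : ∀ m (t : Word m) (P : Word m → Bool) → count m P ≡ count m (λ x → P (t ⊕ x))
count-translate zero [] P = refl
count-translate (suc m) (false ∷ t) P =
  cong₂ _+_ (count-translate m t (P ∘ (false ∷_))) (count-translate m t (P ∘ (true ∷_)))
count-translate (suc m) (true ∷ t) P = trans
  (cong₂ _+_ (count-translate m t (P ∘ (false ∷_))) (count-translate m t (P ∘ (true ∷_))))
  (+-comm (count m (λ x → P (false ∷ (t ⊕ x)))) _)

count-insertAt : ∀ m (k : Fin (suc m)) (P : Word (suc m) → Bool) →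
  count (suc m) P ≡ count m (λ x → P (insertAt x k false)) + count m (λ x → P (insertAt x k true))
count-insertAt m fzero P = refl
count-insertAt (suc m) (fsuc k) P = trans
  (cong₂ _+_ (count-insertAt m k (P ∘ (false ∷_))) (count-insertAt m k (P ∘ (true ∷_))))
  (+-interchange (slice false false) (slice false true) (slice true false) (slice true true))
  where
  slice : Bool → Bool → ℕ
  slice a b = count m (λ x → P (a ∷ insertAt x k b))

double-injective : ∀ a b → a + a ≡ b + b → a ≡ b
double-injective a b e = *-cancelˡ-≡ a b 2 (trans (double a) (trans e (sym (double b))))
  where
  double : ∀ n → 2 * n ≡ n + n
  double = solve-∀

nonzero-by-weight : ∀ {m} (w : Word m) → wt w ≢ 0 → w ≢ zeroW m
nonzero-by-weight {m} w wt≢0 w≡0 = wt≢0 (trans (cong wt w≡0) (wt-zero m))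

module LinearCode {m} (C : Code m) (lin : Linear C) where

  nonzero-weight : ∀ {d} → MinDistance C d → ∀ w → w ∈ᶜ C → w ≢ zeroW m → d ≤ wt w
  nonzero-weight {d} (_ , min) w w∈ w≢0 =
    subst (d ≤_) (cong wt (⊕-identityʳ w)) (min w (zeroW m) w∈ (proj₁ lin) w≢0)

  minimum-weight-word : ∀ {d} → MinDistance C d → ∃[ c ] (c ∈ᶜ C × wt c ≡ d)
  minimum-weight-word ((x , y , x∈ , y∈ , _ , dist≡d) , _) = x ⊕ y , proj₂ lin x y x∈ y∈ , dist≡d

  minDistance-by-weights : ∀ {d} c → c ∈ᶜ C → c ≢ zeroW m → wt c ≡ d →
    (∀ w → w ∈ᶜ C → w ≢ zeroW m → d ≤ wt w) → MinDistance C d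
  minDistance-by-weights {d} c c∈ c≢0 wt-c min-wt =
    (c , zeroW m , c∈ , proj₁ lin , c≢0 , trans (cong wt (⊕-identityʳ c)) wt-c) , apart
    where
    apart : ∀ x y → x ∈ᶜ C → y ∈ᶜ C → x ≢ y → d ≤ dist x y
    apart x y x∈ y∈ x≢y = min-wt (x ⊕ y) (proj₂ lin x y x∈ y∈) (x≢y ∘ ⊕≡zero⇒≡ x y)

-- Self-dual codes and their shadows

module SelfDualCode {m} (D : Code m) (lin : Linear D) (sd : SelfDual D) where

  closed : ∀ {x y} → x ∈ᶜ D → y ∈ᶜ D → (x ⊕ y) ∈ᶜ D
  closed {x} {y} = proj₂ lin x y

  orthogonal : ∀ {x y} → x ∈ᶜ D → y ∈ᶜ D → dot x y ≡ false
  orthogonal {x} x∈ y∈ = dual-elim D x (trans (sym (sd x)) x∈) y∈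

  dual⇒code : ∀ {x} → x ∈ᶜ dual D → x ∈ᶜ D
  dual⇒code {x} e = trans (sd x) e

  translate : ∀ {c} x → c ∈ᶜ D → D (c ⊕ x) ≡ D x
  translate {c} x c∈ =
    ≡-by-true (λ e → subst (λ z → z ∈ᶜ D) (⊕-cancelˡ c x) (closed c∈ e)) (closed c∈)

  -- Codewords are self-orthogonal, hence of even weight: ≡ 0 or 2 (mod 4).
  weight-mod4 : ∀ {y} → y ∈ᶜ D → wt y % 4 ≡ 0 ⊎ wt y % 4 ≡ 2
  weight-mod4 {y} y∈ = subst (λ w → w % 4 ≡ 0 ⊎ w % 4 ≡ 2) (sym even) (double-mod4 k)
    where
    k : ℕ
    k = proj₁ (overlap-parity y y)
    even : wt y ≡ 2 * k
    even = begin
      wt y                  ≡⟨ cong wt (zipWith-idem ∧-idem y) ⟨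
      wt (y ∧ʷ y)           ≡⟨ proj₂ (overlap-parity y y) ⟩
      bit (dot y y) + 2 * k ≡⟨ cong (λ b → bit b + 2 * k) (orthogonal y∈ y∈) ⟩
      2 * k                 ∎
      where open ≡-Reasoning

  ∈doublyEven : ∀ {y} → y ∈ᶜ D → wt y % 4 ≡ 0 → y ∈ᶜ doublyEven D
  ∈doublyEven y∈ e rewrite y∈ | e = refl

  doublyEven-elim : ∀ {y} → y ∈ᶜ doublyEven D → y ∈ᶜ D × wt y % 4 ≡ 0
  doublyEven-elim {y} e = ∧-conicalˡ _ _ e , ≡ᵇ⇒≡ (wt y % 4) 0 (from T-≡ (∧-conicalʳ _ _ e))

  ∈shadow : ∀ {v} → v ∈ᶜ dual (doublyEven D) → D v ≡ false → v ∈ᶜ shadow D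
  ∈shadow v⊥ v∉ rewrite v⊥ | v∉ = refl

  shadow-elim : ∀ {v} → v ∈ᶜ shadow D → v ∈ᶜ dual (doublyEven D) × D v ≡ false
  shadow-elim e = ∧-conicalˡ _ _ e , not-injective (∧-conicalʳ _ _ e)

  shadow-dot-0 : ∀ {v y} → v ∈ᶜ shadow D → y ∈ᶜ D → wt y % 4 ≡ 0 → dot v y ≡ false
  shadow-dot-0 {v} v∈ y∈ e = dual-elim (doublyEven D) v (proj₁ (shadow-elim v∈)) (∈doublyEven y∈ e)

  -- ... and not orthogonal to the other codewords: since v ∉ D = D^⊥, some
  -- codeword y₁ has v·y₁ = 1; it is not doubly-even, so y ⊕ y₁ is, and v·y = v·y₁.
  shadow-dot-2 : ∀ {v y} → v ∈ᶜ shadow D → y ∈ᶜ D → wt y % 4 ≡ 2 → dot v y ≡ true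
  shadow-dot-2 {v} {y} v∈ y∈ e with dual-witness D v (trans (sym (sd v)) (proj₂ (shadow-elim v∈)))
  ... | y₁ , y₁∈ , vy₁ with weight-mod4 y₁∈
  ... | inj₁ e₁ = ⊥-elim (not-¬ vy₁ (shadow-dot-0 v∈ y₁∈ e₁))
  ... | inj₂ e₁ = trans (xor≡false⇒≡ (dot v y) (dot v y₁) (trans (sym (dot-⊕ʳ v y y₁)) sum⊥)) vy₁
    where
    sum⊥ : dot v (y ⊕ y₁) ≡ false
    sum⊥ = shadow-dot-0 v∈ (closed y∈ y₁∈) (orthogonal-sum-mod4 y y₁ (orthogonal y∈ y₁∈) e e₁)

  shadow-sum : ∀ {v w} → v ∈ᶜ shadow D → w ∈ᶜ shadow D → (v ⊕ w) ∈ᶜ D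
  shadow-sum {v} {w} v∈ w∈ = dual⇒code (dual-intro D (v ⊕ w) sum⊥)
    where
    sum⊥ : ∀ y → y ∈ᶜ D → dot (v ⊕ w) y ≡ false
    sum⊥ y y∈ = trans (dot-⊕ˡ v w y) (≡⇒xor≡false (same-product (weight-mod4 y∈)))
      where
      same-product : wt y % 4 ≡ 0 ⊎ wt y % 4 ≡ 2 → dot v y ≡ dot w y
      same-product (inj₁ e) = trans (shadow-dot-0 v∈ y∈ e) (sym (shadow-dot-0 w∈ y∈ e))
      same-product (inj₂ e) = trans (shadow-dot-2 v∈ y∈ e) (sym (shadow-dot-2 w∈ y∈ e))

  shadow-translate : ∀ {v c} → v ∈ᶜ shadow D → c ∈ᶜ D → (v ⊕ c) ∈ᶜ shadow D
  shadow-translate {v} {c} v∈ c∈ = ∈shadow (dual-intro (doublyEven D) (v ⊕ c) sum⊥) (¬-not sum∉)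
    where
    sum⊥ : ∀ y → y ∈ᶜ doublyEven D → dot (v ⊕ c) y ≡ false
    sum⊥ y y∈ = trans (dot-⊕ˡ v c y)
      (cong₂ _xor_ (dual-elim (doublyEven D) v (proj₁ (shadow-elim v∈)) y∈)
                   (orthogonal c∈ (proj₁ (doublyEven-elim y∈))))
    sum∉ : D (v ⊕ c) ≢ true
    sum∉ e = not-¬ (subst (λ z → z ∈ᶜ D) (trans (cong (c ⊕_) (⊕-comm v c)) (⊕-cancelˡ c v)) (closed c∈ e))
                   (proj₂ (shadow-elim v∈))

  -- Then u · c = 1 gives a common one i
  -- of u and c, and c ⊄ u (else u ⊕ c would be a shadow vector of weight
  -- wt u - wt c < wt u) gives a coordinate j with c_j = 1 and u_j = 0.
  subtraction-coordinates : ∀ {u c s} → u ∈ᶜ shadow D → wt u ≡ s → (∀ x → x ∈ᶜ shadow D → s ≤ wt x) →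
    c ∈ᶜ D → wt c % 4 ≡ 2 →
    ∃[ i ] ∃[ j ] ((lookup u i ≡ true × lookup c i ≡ true) × (lookup c j ≡ true × lookup u j ≡ false))
  subtraction-coordinates {u} {c} u∈ wt-u u-min c∈ e
    with common-one u c (shadow-dot-2 u∈ c∈ e) | outside-or-contained u c
  ... | i , ui , ci | inj₁ (j , cj , uj) = i , j , (ui , ci) , (cj , uj)
  ... | _ | inj₂ contained = ⊥-elim (zero-mod4 (subst (λ w → w % 4 ≡ 2) wt-c≡0 e))
    where
    zero-mod4 : 0 % 4 ≢ 2
    zero-mod4 ()
    wt-c≡0 : wt c ≡ 0
    wt-c≡0 = n≤0⇒n≡0 (+-cancelˡ-≤ (wt (u ⊕ c)) (wt c) 0
      (subst₂ _≤_ (trans (sym wt-u) (sym contained)) (sym (+-identityʳ _))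
                  (u-min (u ⊕ c) (shadow-translate u∈ c∈))))

-- Deleting coordinates

wt-removeAt : ∀ {m} (x : Word (suc m)) k → wt x ≡ bit (lookup x k) + wt (removeAt x k)
wt-removeAt (false ∷ x) fzero = refl
wt-removeAt (true ∷ x) fzero = refl
wt-removeAt (false ∷ y ∷ x) (fsuc k) = wt-removeAt (y ∷ x) k
wt-removeAt (true ∷ y ∷ x) (fsuc k) =
  trans (cong suc (wt-removeAt (y ∷ x) k)) (sym (+-suc (bit (lookup (y ∷ x) k)) _))

dot-removeAt : ∀ {m} (x y : Word (suc m)) k →
  dot x y ≡ (lookup x k ∧ lookup y k) xor dot (removeAt x k) (removeAt y k)
dot-removeAt (a ∷ x) (b ∷ y) fzero = refl
dot-removeAt (a ∷ a' ∷ x) (b ∷ b' ∷ y) (fsuc k) = begin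
  (a ∧ b) xor dot (a' ∷ x) (b' ∷ y) ≡⟨ cong ((a ∧ b) xor_) (dot-removeAt (a' ∷ x) (b' ∷ y) k) ⟩
  (a ∧ b) xor (atK xor rest)        ≡⟨ xor-assoc (a ∧ b) atK rest ⟨
  ((a ∧ b) xor atK) xor rest        ≡⟨ cong (_xor rest) (xor-comm (a ∧ b) atK) ⟩
  (atK xor (a ∧ b)) xor rest        ≡⟨ xor-assoc atK (a ∧ b) rest ⟩
  atK xor ((a ∧ b) xor rest)        ∎
  where
  open ≡-Reasoning
  atK rest : Bool
  atK = lookup (a' ∷ x) k ∧ lookup (b' ∷ y) k
  rest = dot (removeAt (a' ∷ x) k) (removeAt (b' ∷ y) k)

removeAt-⊕ : ∀ {m} (x y : Word (suc m)) k → removeAt (x ⊕ y) k ≡ removeAt x k ⊕ removeAt y k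
removeAt-⊕ (a ∷ x) (b ∷ y) fzero = refl
removeAt-⊕ (a ∷ a' ∷ x) (b ∷ b' ∷ y) (fsuc k) = cong ((a xor b) ∷_) (removeAt-⊕ (a' ∷ x) (b' ∷ y) k)

removeAt-zero : ∀ m k → removeAt (zeroW (suc m)) k ≡ zeroW m
removeAt-zero m fzero = refl
removeAt-zero (suc m) (fsuc k) = cong (false ∷_) (removeAt-zero m k)

-- Two coordinates i ≠ j of words of length m + 2.  del deletes them as
-- subtract11 does (first i, then the position punchOut i≢j that j takes in the
-- shortened word); ins a b x inserts a at i and b at j; δ c tests whether c
-- differs at i and j.
module TwoCoordinates {m} (i j : Fin (suc (suc m))) (i≢j : i ≢ j) where

  p : Fin (suc m)
  p = punchOut i≢j

  del : Word (suc (suc m)) → Word m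
  del c = removeAt (removeAt c i) p

  ins : Bool → Bool → Word m → Word (suc (suc m))
  ins a b x = insertAt (insertAt x p b) i a

  δ : Word (suc (suc m)) → Bool
  δ c = lookup c i xor lookup c j

  lookup-p : ∀ (c : Word (suc (suc m))) → lookup (removeAt c i) p ≡ lookup c j
  lookup-p c = removeAt-punchOut c i≢j

  del-ins : ∀ a b x → del (ins a b x) ≡ x
  del-ins a b x rewrite removeAt-insertAt (insertAt x p b) i a = removeAt-insertAt x p b

  ins-i : ∀ a b x → lookup (ins a b x) i ≡ a
  ins-i a b x = insertAt-lookup (insertAt x p b) i a

  ins-j : ∀ a b x → lookup (ins a b x) j ≡ b
  ins-j a b x = subst (λ k → lookup (ins a b x) k ≡ b) (punchIn-punchOut i≢j)
    (trans (insertAt-punchIn (insertAt x p b) i a p) (insertAt-lookup x p b))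

  ins-del : ∀ c → ins (lookup c i) (lookup c j) (del c) ≡ c
  ins-del c = begin
    insertAt (insertAt (removeAt (removeAt c i) p) p (lookup c j)) i (lookup c i)
      ≡⟨ cong (λ b → insertAt (insertAt (removeAt (removeAt c i) p) p b) i (lookup c i)) (lookup-p c) ⟨
    insertAt (insertAt (removeAt (removeAt c i) p) p (lookup (removeAt c i) p)) i (lookup c i)
      ≡⟨ cong (λ z → insertAt z i (lookup c i)) (insertAt-removeAt (removeAt c i) p) ⟩
    insertAt (removeAt c i) i (lookup c i)
      ≡⟨ insertAt-removeAt c i ⟩
    c ∎
    where open ≡-Reasoning

  wt-del : ∀ c → wt c ≡ bit (lookup c i) + (bit (lookup c j) + wt (del c))
  wt-del c = trans (wt-removeAt c i) (cong (bit (lookup c i) +_)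
    (trans (wt-removeAt (removeAt c i) p) (cong (λ b → bit b + wt (del c)) (lookup-p c))))

  dot-del : ∀ c c' →
    dot c c' ≡ ((lookup c i ∧ lookup c' i) xor (lookup c j ∧ lookup c' j)) xor dot (del c) (del c')
  dot-del c c' = begin
    dot c c'
      ≡⟨ dot-removeAt c c' i ⟩
    atI xor dot (removeAt c i) (removeAt c' i)
      ≡⟨ cong (atI xor_) (dot-removeAt (removeAt c i) (removeAt c' i) p) ⟩
    atI xor ((lookup (removeAt c i) p ∧ lookup (removeAt c' i) p) xor rest)
      ≡⟨ cong₂ (λ a b → atI xor ((a ∧ b) xor rest)) (lookup-p c) (lookup-p c') ⟩
    atI xor (atJ xor rest)
      ≡⟨ xor-assoc atI atJ rest ⟨
    (atI xor atJ) xor rest ∎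
    where
    open ≡-Reasoning
    atI atJ rest : Bool
    atI = lookup c i ∧ lookup c' i
    atJ = lookup c j ∧ lookup c' j
    rest = dot (del c) (del c')

  del-⊕ : ∀ c c' → del (c ⊕ c') ≡ del c ⊕ del c'
  del-⊕ c c' rewrite removeAt-⊕ c c' i = removeAt-⊕ (removeAt c i) (removeAt c' i) p

  del-zero : del (zeroW (suc (suc m))) ≡ zeroW m
  del-zero rewrite removeAt-zero (suc m) i = removeAt-zero m p

  agree⇒δ : ∀ c → lookup c i ≡ lookup c j → δ c ≡ false
  agree⇒δ c = ≡⇒xor≡false

  δ⇒agree : ∀ c → δ c ≡ false → lookup c i ≡ lookup c j
  δ⇒agree c = xor≡false⇒≡ (lookup c i) (lookup c j)

  δ-⊕ : ∀ c c' → δ (c ⊕ c') ≡ δ c xor δ c'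
  δ-⊕ c c' = begin
    lookup (c ⊕ c') i xor lookup (c ⊕ c') j
      ≡⟨ cong₂ _xor_ (lookup-⊕ c c' i) (lookup-⊕ c c' j) ⟩
    (lookup c i xor lookup c' i) xor (lookup c j xor lookup c' j)
      ≡⟨ xor-interchange (lookup c i) (lookup c' i) (lookup c j) (lookup c' j) ⟩
    δ c xor δ c' ∎
    where open ≡-Reasoning

  δ-ins : ∀ a b x → δ (ins a b x) ≡ a xor b
  δ-ins a b x = cong₂ _xor_ (ins-i a b x) (ins-j a b x)

  ins-⊕ : ∀ a b a' b' x x' → ins a b x ⊕ ins a' b' x' ≡ ins (a xor a') (b xor b') (x ⊕ x')
  ins-⊕ a b a' b' x x' = begin
    w                                           ≡⟨ ins-del w ⟨
    ins (lookup w i) (lookup w j) (del w)       ≡⟨ cong₂ (λ a b → ins a b (del w)) wi wj ⟩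
    ins (a xor a') (b xor b') (del w)           ≡⟨ cong (ins (a xor a') (b xor b')) dw ⟩
    ins (a xor a') (b xor b') (x ⊕ x')          ∎
    where
    open ≡-Reasoning
    w : Word (suc (suc m))
    w = ins a b x ⊕ ins a' b' x'
    wi : lookup w i ≡ a xor a'
    wi = trans (lookup-⊕ (ins a b x) _ i) (cong₂ _xor_ (ins-i a b x) (ins-i a' b' x'))
    wj : lookup w j ≡ b xor b'
    wj = trans (lookup-⊕ (ins a b x) _ j) (cong₂ _xor_ (ins-j a b x) (ins-j a' b' x'))
    dw : del w ≡ x ⊕ x'
    dw = trans (del-⊕ (ins a b x) _) (cong₂ _⊕_ (del-ins a b x) (del-ins a' b' x'))

  dot-ins : ∀ a b x c → dot (ins a b x) c ≡ ((a ∧ lookup c i) xor (b ∧ lookup c j)) xor dot x (del c)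
  dot-ins a b x c rewrite dot-del (ins a b x) c | ins-i a b x | ins-j a b x | del-ins a b x = refl

  wt-del-agree : ∀ c → δ c ≡ false → wt c ≡ bit (lookup c i) + (bit (lookup c i) + wt (del c))
  wt-del-agree c agree =
    trans (wt-del c) (cong (λ b → bit (lookup c i) + (bit b + wt (del c))) (sym (δ⇒agree c agree)))

  wt-del-≤ : ∀ c → wt c ≤ 2 + wt (del c)
  wt-del-≤ c = subst (_≤ 2 + wt (del c)) (sym (wt-del c))
    (+-mono-≤ (bit≤1 (lookup c i)) (+-mono-≤ (bit≤1 (lookup c j)) ≤-refl))

  wt-del-δ : ∀ c → δ c ≡ true → wt c ≡ suc (wt (del c))
  wt-del-δ c e = trans (wt-del c) (one (lookup c i) (lookup c j) e)
    where
    one : ∀ a b → a xor b ≡ true → bit a + (bit b + wt (del c)) ≡ suc (wt (del c))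
    one false true _ = refl
    one true false _ = refl

  pair : Word (suc (suc m))
  pair = ins true true (zeroW m)

  wt-pair : wt pair ≡ 2
  wt-pair = begin
    wt pair                                                       ≡⟨ wt-del pair ⟩
    bit (lookup pair i) + (bit (lookup pair j) + wt (del pair))   ≡⟨ cong₂ (λ a b → bit a + (bit b + wt (del pair)))
                                                                           (ins-i true true (zeroW m)) (ins-j true true (zeroW m)) ⟩
    2 + wt (del pair)                                             ≡⟨ cong (λ x → 2 + wt x) (del-ins true true (zeroW m)) ⟩
    2 + wt (zeroW m)                                              ≡⟨ cong (2 +_) (wt-zero m) ⟩
    2                                                             ∎
    where open ≡-Reasoning

-- Subtraction of (11)

module Subtraction {m} (C : Code (suc (suc m))) (i j : Fin (suc (suc m))) (i≢j : i ≢ j) where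

  open TwoCoordinates i j i≢j public

  C' : Code m
  C' = subtract11 C i j i≢j

  ∈C' : ∀ c → c ∈ᶜ C → δ c ≡ false → del c ∈ᶜ C'
  ∈C' c c∈ agree = any-intro _ (∈-allWords c) (cong₂ _∧_ c∈ (cong₂ _∧_ pattern11 (eqW-refl (del c))))
    where
    pattern11 : eqW (lookup c i ∷ []) (lookup c j ∷ []) ≡ true
    pattern11 = subst (λ b → eqW (b ∷ []) (lookup c j ∷ []) ≡ true)
                      (sym (δ⇒agree c agree)) (eqW-refl (lookup c j ∷ []))

  C'-lift : ∀ x → x ∈ᶜ C' → ∃[ c ] (c ∈ᶜ C × δ c ≡ false × del c ≡ x)
  C'-lift x x∈ with any-elim _ (allWords (suc (suc m))) x∈
  ... | c , found = c , ∧-conicalˡ _ _ found ,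
    agree⇒δ c (cong head (eqW-sound (lookup c i ∷ []) (lookup c j ∷ []) (∧-conicalˡ _ _ tests))) ,
    eqW-sound (del c) x (∧-conicalʳ _ _ tests)
    where
    tests : (eqW (lookup c i ∷ []) (lookup c j ∷ []) ∧ eqW (del c) x) ≡ true
    tests = ∧-conicalʳ (C c) _ found

  C'-by-lifts : ∀ x → C' x ≡ (C (ins false false x) ∨ C (ins true true x))
  C'-by-lifts x = ≡-by-true lifted unlifted
    where
    lifted : x ∈ᶜ C' → (C (ins false false x) ∨ C (ins true true x)) ≡ true
    lifted x∈ with C'-lift x x∈
    ... | c , c∈ , agree , refl = one-lift (lookup c i) (subst (λ z → z ∈ᶜ C) c-as-lift c∈)
      where
      c-as-lift : c ≡ ins (lookup c i) (lookup c i) (del c)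
      c-as-lift = trans (sym (ins-del c)) (cong (λ b → ins (lookup c i) b (del c)) (sym (δ⇒agree c agree)))
      one-lift : ∀ a → ins a a (del c) ∈ᶜ C → (C (ins false false (del c)) ∨ C (ins true true (del c))) ≡ true
      one-lift false e rewrite e = refl
      one-lift true e rewrite e = ∨-zeroʳ _
    unlifted : (C (ins false false x) ∨ C (ins true true x)) ≡ true → x ∈ᶜ C'
    unlifted e with C (ins false false x) in e₀
    ... | true = subst (λ z → z ∈ᶜ C') (del-ins false false x) (∈C' _ e₀ (δ-ins false false x))
    ... | false = subst (λ z → z ∈ᶜ C') (del-ins true true x) (∈C' _ e (δ-ins true true x))

  module FromSelfDual (lin : Linear C) (sd : SelfDual C) (pair∉C : C pair ≡ false) where

    open SelfDualCode C lin sd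

    -- Since pair ∉ C = C^⊥, some codeword is not orthogonal to pair, i.e. differs at i and j.
    separating : ∃[ c ] (c ∈ᶜ C × δ c ≡ true)
    separating with dual-witness C pair (trans (sym (sd pair)) pair∉C)
    ... | c , c∈ , pair·c = c , c∈ , trans (sym pair·c≡δ) pair·c
      where
      pair·c≡δ : dot pair c ≡ δ c
      pair·c≡δ = trans (dot-ins true true (zeroW m) c)
                       (trans (cong (δ c xor_) (dot-zeroˡ (del c))) (xor-identityʳ (δ c)))

    c₀ : Word (suc (suc m))
    c₀ = proj₁ separating

    c₀∈ : c₀ ∈ᶜ C
    c₀∈ = proj₁ (proj₂ separating)

    δc₀ : δ c₀ ≡ true
    δc₀ = proj₂ (proj₂ separating)

    linear' : Linear C'
    linear' = subst (λ z → z ∈ᶜ C') del-zero (∈C' _ (proj₁ lin) δ-zero) , closed'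
      where
      δ-zero : δ (zeroW (suc (suc m))) ≡ false
      δ-zero = cong₂ _xor_ (lookup-replicate i false) (lookup-replicate j false)
      closed' : ∀ x y → x ∈ᶜ C' → y ∈ᶜ C' → (x ⊕ y) ∈ᶜ C'
      closed' x y x∈ y∈ with C'-lift x x∈ | C'-lift y y∈
      ... | c , c∈ , δc , refl | c' , c'∈ , δc' , refl =
        subst (λ z → z ∈ᶜ C') (del-⊕ c c')
          (∈C' (c ⊕ c') (closed c∈ c'∈) (trans (δ-⊕ c c') (cong₂ _xor_ δc δc')))

    orthogonal' : ∀ {c c'} → c ∈ᶜ C → c' ∈ᶜ C → δ c ≡ false → δ c' ≡ false →
                  dot (del c) (del c') ≡ false
    orthogonal' {c} {c'} c∈ c'∈ δc δc' = begin
      dot (del c) (del c')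
        ≡⟨ cong (_xor dot (del c) (del c')) at-ij ⟨
      ((lookup c i ∧ lookup c' i) xor (lookup c j ∧ lookup c' j)) xor dot (del c) (del c')
        ≡⟨ dot-del c c' ⟨
      dot c c'
        ≡⟨ orthogonal c∈ c'∈ ⟩
      false ∎
      where
      open ≡-Reasoning
      at-ij : (lookup c i ∧ lookup c' i) xor (lookup c j ∧ lookup c' j) ≡ false
      at-ij = ≡⇒xor≡false (cong₂ _∧_ (δ⇒agree c δc) (δ⇒agree c' δc'))

    -- A word x ∈ C'^⊥ satisfies x · del c = a ∧ δ c for every c ∈ C, where a = x · del c₀:
    -- if c differs at i and j, then c ⊕ c₀ does not.
    dual'-dot : ∀ {x c} → x ∈ᶜ dual C' → c ∈ᶜ C → dot x (del c) ≡ dot x (del c₀) ∧ δ c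
    dual'-dot {x} {c} x∈ c∈ with δ c in δc
    ... | false = trans (dual-elim C' x x∈ (∈C' c c∈ δc)) (sym (∧-zeroʳ _))
    ... | true = trans (xor≡false⇒≡ _ _ sum⊥) (sym (∧-identityʳ _))
      where
      sum⊥ : dot x (del c) xor dot x (del c₀) ≡ false
      sum⊥ = begin
        dot x (del c) xor dot x (del c₀) ≡⟨ dot-⊕ʳ x (del c) (del c₀) ⟨
        dot x (del c ⊕ del c₀)           ≡⟨ cong (dot x) (del-⊕ c c₀) ⟨
        dot x (del (c ⊕ c₀))             ≡⟨ dual-elim C' x x∈ (∈C' (c ⊕ c₀) (closed c∈ c₀∈) sum-agrees) ⟩
        false                            ∎
        where
        open ≡-Reasoning
        sum-agrees : δ (c ⊕ c₀) ≡ false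
        sum-agrees = trans (δ-⊕ c c₀) (cong₂ _xor_ δc δc₀)

    -- C' is self-dual: C' ⊆ C'^⊥ by orthogonal', and x ∈ C'^⊥ lifts to
    -- ins a a x ∈ C^⊥ = C with a = x · del c₀ by dual'-dot.
    self-dual' : SelfDual C'
    self-dual' x = ≡-by-true code⇒dual dual⇒code'
      where
      code⇒dual : x ∈ᶜ C' → x ∈ᶜ dual C'
      code⇒dual x∈ with C'-lift x x∈
      ... | c , c∈ , δc , refl = dual-intro C' (del c) del-c⊥
        where
        del-c⊥ : ∀ y → y ∈ᶜ C' → dot (del c) y ≡ false
        del-c⊥ y y∈ with C'-lift y y∈
        ... | c' , c'∈ , δc' , refl = orthogonal' c∈ c'∈ δc δc'
      dual⇒code' : x ∈ᶜ dual C' → x ∈ᶜ C'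
      dual⇒code' x∈ = subst (λ z → z ∈ᶜ C') (del-ins a a x)
        (∈C' lift (dual⇒code (dual-intro C lift lift⊥)) (trans (δ-ins a a x) (xor-same a)))
        where
        a : Bool
        a = dot x (del c₀)
        lift : Word (suc (suc m))
        lift = ins a a x
        lift⊥ : ∀ c → c ∈ᶜ C → dot lift c ≡ false
        lift⊥ c c∈ = begin
          dot lift c
            ≡⟨ dot-ins a a x c ⟩
          ((a ∧ lookup c i) xor (a ∧ lookup c j)) xor dot x (del c)
            ≡⟨ cong₂ _xor_ (∧-distribˡ-xor a (lookup c i) (lookup c j)) (sym (dual'-dot {x} {c} x∈ c∈)) ⟨
          (a ∧ δ c) xor (a ∧ δ c)
            ≡⟨ xor-same (a ∧ δ c) ⟩
          false ∎
          where open ≡-Reasoning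

    agreeing : Code (suc (suc m))
    agreeing c = C c ∧ not (δ c)

    -- Translation by c₀ exchanges the codewords differing at i, j with the agreeing ones.
    differing≡agreeing : count (suc (suc m)) (λ c → C c ∧ δ c) ≡ count (suc (suc m)) agreeing
    differing≡agreeing = trans (count-translate (suc (suc m)) c₀ (λ c → C c ∧ δ c))
      (count-cong (suc (suc m)) (λ x → cong₂ _∧_ (translate x c₀∈) (flips x)))
      where
      flips : ∀ x → δ (c₀ ⊕ x) ≡ not (δ x)
      flips x = trans (δ-⊕ c₀ x) (cong (_xor δ x) δc₀)

    lifts-disjoint : ∀ x → (C (ins false false x) ∧ C (ins true true x)) ≡ false
    lifts-disjoint x = ¬-not both∈
      where
      lifts-sum : ins false false x ⊕ ins true true x ≡ pair
      lifts-sum = trans (ins-⊕ false false true true x x) (cong (ins true true) (⊕-self x))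
      both∈ : (C (ins false false x) ∧ C (ins true true x)) ≢ true
      both∈ e = not-¬ (subst (λ z → z ∈ᶜ C) lifts-sum
                              (closed (∧-conicalˡ _ _ e) (∧-conicalʳ (C (ins false false x)) _ e)))
                      pair∉C

    -- Counting by the entries at i and j: the agreeing codewords are the lifts of C'.
    agreeing≡C' : count (suc (suc m)) agreeing ≡ count m C'
    agreeing≡C' = begin
      count (suc (suc m)) agreeing
        ≡⟨ count-insertAt (suc m) i agreeing ⟩
      count (suc m) (λ y → agreeing (insertAt y i false)) + count (suc m) (λ y → agreeing (insertAt y i true))
        ≡⟨ cong₂ _+_ (count-insertAt m p (λ y → agreeing (insertAt y i false)))
                     (count-insertAt m p (λ y → agreeing (insertAt y i true))) ⟩
      (slice false false + slice false true) + (slice true false + slice true true)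
        ≡⟨ cong₂ _+_ (cong₂ _+_ (count-cong m (λ x → trans (agreeing-ins false false x) (∧-identityʳ _)))
                                (count-none m _ (λ x → trans (agreeing-ins false true x) (∧-zeroʳ _))))
                     (cong₂ _+_ (count-none m _ (λ x → trans (agreeing-ins true false x) (∧-zeroʳ _)))
                                (count-cong m (λ x → trans (agreeing-ins true true x) (∧-identityʳ _)))) ⟩
      (lifts false + 0) + (0 + lifts true)
        ≡⟨ cong (_+ lifts true) (+-identityʳ (lifts false)) ⟩
      lifts false + lifts true
        ≡⟨ count-∨ m (λ x → C (ins false false x)) (λ x → C (ins true true x)) lifts-disjoint ⟨
      count m (λ x → C (ins false false x) ∨ C (ins true true x))
        ≡⟨ count-cong m (λ x → sym (C'-by-lifts x)) ⟩
      count m C' ∎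
      where
      open ≡-Reasoning
      slice : Bool → Bool → ℕ
      slice a b = count m (λ x → agreeing (ins a b x))
      lifts : Bool → ℕ
      lifts a = count m (λ x → C (ins a a x))
      agreeing-ins : ∀ a b x → agreeing (ins a b x) ≡ C (ins a b x) ∧ not (a xor b)
      agreeing-ins a b x = cong (λ t → C (ins a b x) ∧ not t) (δ-ins a b x)

    card-halves : card C ≡ card C' + card C'
    card-halves = begin
      card C                                                        ≡⟨ card≡count C ⟩
      count (suc (suc m)) C                                         ≡⟨ count-split (suc (suc m)) C δ ⟩
      count (suc (suc m)) (λ c → C c ∧ δ c) + count (suc (suc m)) agreeing
                                                                    ≡⟨ cong (_+ count (suc (suc m)) agreeing) differing≡agreeing ⟩
      count (suc (suc m)) agreeing + count (suc (suc m)) agreeing   ≡⟨ cong₂ _+_ agreeing≡C' agreeing≡C' ⟩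
      count m C' + count m C'                                       ≡⟨ cong₂ _+_ (card≡count C') (card≡count C') ⟨
      card C' + card C'                                             ∎
      where open ≡-Reasoning

module Reduction {m k d s} (C : Code (suc (suc m))) (sd : SelfDual C)
  (code : IsCode C (suc k) (d + 2)) (d≢0 : d ≢ 0) (shadow-min : ShadowMinWeight C s) (3≤s : 3 ≤ s)
  {c u : Word (suc (suc m))} (c∈ : c ∈ᶜ C) (wt-c : wt c ≡ d + 2) (u∈ : u ∈ᶜ shadow C) (wt-u : wt u ≡ s)
  {i j : Fin (suc (suc m))} (ui : lookup u i ≡ true) (ci : lookup c i ≡ true)
  (cj : lookup c j ≡ true) (uj : lookup u j ≡ false) where

  lin : Linear C
  lin = proj₁ code

  open SelfDualCode C lin sd
  open LinearCode C lin

  i≢j : i ≢ j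
  i≢j i≡j = not-¬ ui (trans (cong (lookup u) i≡j) uj)

  open Subtraction C i j i≢j

  -- The weight-2 word on {i, j} is lighter than d + 2 > 2, hence not in C.
  pair∉C : C pair ≡ false
  pair∉C = ¬-not λ pair∈ → d≢0 (n≤0⇒n≡0 (+-cancelʳ-≤ 2 d 0
    (subst (d + 2 ≤_) wt-pair (nonzero-weight (proj₂ (proj₂ code)) pair pair∈
      (nonzero-by-weight pair (λ wt≡0 → 0≢2 (trans (sym wt≡0) wt-pair)))))))
    where
    0≢2 : 0 ≢ 2
    0≢2 ()

  open FromSelfDual lin sd pair∉C public using (self-dual'; linear'; card-halves)
  module S' = SelfDualCode C' linear' self-dual'

  size' : card C' ≡ pow2 k
  size' = double-injective (card C') (pow2 k) (trans (sym card-halves) (proj₁ (proj₂ code)))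

  -- Minimum distance: del c has weight d, and a nonzero w ∈ C' lifts to a nonzero
  -- codeword of weight at most wt w + 2.
  wt-del-c : wt (del c) ≡ d
  wt-del-c = suc-injective (suc-injective (trans (sym wt-c-del) (trans wt-c (+-comm d 2))))
    where
    wt-c-del : wt c ≡ 2 + wt (del c)
    wt-c-del = trans (wt-del c) (cong₂ (λ a b → bit a + (bit b + wt (del c))) ci cj)

  distance' : MinDistance C' d
  distance' = LinearCode.minDistance-by-weights C' linear' (del c) (∈C' c c∈ (agree⇒δ c (trans ci (sym cj))))
    (nonzero-by-weight (del c) (λ wt≡0 → d≢0 (trans (sym wt-del-c) wt≡0))) wt-del-c lifted-weight
    where
    lifted-weight : ∀ w → w ∈ᶜ C' → w ≢ zeroW m → d ≤ wt w
    lifted-weight w w∈ w≢0 with C'-lift w w∈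
    ... | c' , c'∈ , _ , refl = +-cancelʳ-≤ 2 d (wt (del c'))
      (≤-trans (nonzero-weight (proj₂ (proj₂ code)) c' c'∈ c'≢0)
               (subst (wt c' ≤_) (+-comm 2 (wt (del c'))) (wt-del-≤ c')))
      where
      c'≢0 : c' ≢ zeroW (suc (suc m))
      c'≢0 c'≡0 = w≢0 (trans (cong del c'≡0) del-zero)

  -- Shadow: u' = del u has weight s - 1, and u ⊕ c₁ is a shadow vector of C for
  -- every codeword c₁ agreeing at i and j, of weight 1 + wt (u' ⊕ del c₁).
  u' : Word m
  u' = del u

  δu : δ u ≡ true
  δu = cong₂ _xor_ ui uj

  wt-u' : wt u' ≡ s ∸ 1
  wt-u' = sym (cong (_∸ 1) (trans (sym wt-u) (wt-del-δ u δu)))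

  shadow-lift : ∀ c₁ → c₁ ∈ᶜ C → δ c₁ ≡ false → s ≤ suc (wt (u' ⊕ del c₁))
  shadow-lift c₁ c₁∈ δc₁ = subst (s ≤_) wt-sum (proj₂ shadow-min (u ⊕ c₁) (shadow-translate u∈ c₁∈))
    where
    wt-sum : wt (u ⊕ c₁) ≡ suc (wt (u' ⊕ del c₁))
    wt-sum = trans (wt-del-δ (u ⊕ c₁) (trans (δ-⊕ u c₁) (cong₂ _xor_ δu δc₁)))
                   (cong (suc ∘ wt) (del-⊕ u c₁))

  dot-u : ∀ c' → dot u c' ≡ (lookup c' i xor false) xor dot u' (del c')
  dot-u c' = trans (dot-del u c')
    (cong (_xor dot u' (del c')) (cong₂ (λ a b → (a ∧ lookup c' i) xor (b ∧ lookup c' j)) ui uj))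

  -- u' is orthogonal to the doubly-even words of C': such a word y lifts to a
  -- codeword c' with entries a, a at i, j, of weight wt y + 2a, and u · c' = a ⊕ u' · y.
  u'⊥ : ∀ y → y ∈ᶜ doublyEven C' → dot u' y ≡ false
  u'⊥ y y∈ with S'.doublyEven-elim y∈
  ... | y∈C' , y-mod4 with C'-lift y y∈C'
  ... | c' , c'∈ , δc' , refl with lookup c' i | dot-u c' | wt-del-agree c' δc'
  ... | false | u·c' | wt-c' = trans (sym u·c') (shadow-dot-0 u∈ c'∈ (trans (cong (_% 4) wt-c') y-mod4))
  ... | true | u·c' | wt-c' =
    not-injective (trans (sym u·c') (shadow-dot-2 u∈ c'∈ (trans (cong (_% 4) wt-c') (plus2-mod4 (wt (del c')) y-mod4))))

  -- u' ∉ C': otherwise u ⊕ c₁ would be a shadow vector of weight 1 < s.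
  u'∉C' : C' u' ≡ false
  u'∉C' = ¬-not u'∈C'-impossible
    where
    3≰1 : 3 ≤ 1 → ⊥
    3≰1 (s≤s ())
    u'∈C'-impossible : u' ∈ᶜ C' → ⊥
    u'∈C'-impossible u'∈ with C'-lift u' u'∈
    ... | c₁ , c₁∈ , δc₁ , del-c₁ =
      3≰1 (≤-trans 3≤s (subst (λ w → s ≤ suc w) weight-zero (shadow-lift c₁ c₁∈ δc₁)))
      where
      weight-zero : wt (u' ⊕ del c₁) ≡ 0
      weight-zero = trans (cong (λ z → wt (u' ⊕ z)) del-c₁) (trans (cong wt (⊕-self u')) (wt-zero m))

  u'∈S' : u' ∈ᶜ shadow C'
  u'∈S' = S'.∈shadow {u'} (dual-intro (doublyEven C') u' u'⊥) u'∉C'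

  -- Every shadow vector x of C' satisfies x ⊕ u' ∈ C', and lifting gives s ≤ wt x + 1.
  shadow-lower-bound : ∀ x → x ∈ᶜ shadow C' → s ∸ 1 ≤ wt x
  shadow-lower-bound x x∈ = lift-bound (C'-lift (x ⊕ u') (S'.shadow-sum {x} {u'} x∈ u'∈S'))
    where
    lift-bound : ∃[ c₁ ] (c₁ ∈ᶜ C × δ c₁ ≡ false × del c₁ ≡ x ⊕ u') → s ∸ 1 ≤ wt x
    lift-bound (c₁ , c₁∈ , δc₁ , del-c₁) =
      ∸-monoˡ-≤ 1 (subst (λ z → s ≤ suc (wt z)) recovers-x (shadow-lift c₁ c₁∈ δc₁))
      where
      recovers-x : u' ⊕ del c₁ ≡ x
      recovers-x = trans (cong (u' ⊕_) (trans del-c₁ (⊕-comm x u'))) (⊕-cancelˡ u' x)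

  shadow' : ShadowMinWeight C' (s ∸ 1)
  shadow' = (u' , u'∈S' , wt-u') , shadow-lower-bound

  code' : IsCode C' k d
  code' = linear' , size' , distance'

mainTheorem2 : (n d s : ℕ) → 1 ≤ n → d % 4 ≡ 0 → d ≢ 0 →
    (C : Code (suc (suc (4 * n)))) → SelfDual C → IsCode C (suc (2 * n)) (d + 2) →
    ShadowMinWeight C s → 3 ≤ s →
    ∃[ i ] ∃[ j ] Σ (i ≢ j) (λ i≢j →
      SelfDual (subtract11 C i j i≢j) × IsCode (subtract11 C i j i≢j) (2 * n) d ×
      ShadowMinWeight (subtract11 C i j i≢j) (s ∸ 1))
mainTheorem2 n d s _ d%4 d≢0 C sd code shadow-min 3≤s
  with LinearCode.minimum-weight-word C (proj₁ code) (proj₂ (proj₂ code)) | proj₁ shadow-min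
... | c , c∈ , wt-c | u , u∈ , wt-u
  with SelfDualCode.subtraction-coordinates C (proj₁ code) sd u∈ wt-u (proj₂ shadow-min) c∈
         (trans (cong (_% 4) wt-c) (plus2-mod4ʳ d d%4))
... | i , j , (ui , ci) , (cj , uj) = i , j , i≢j , self-dual' , code' , shadow'
  where open Reduction {k = 2 * n} C sd code d≢0 shadow-min 3≤s c∈ wt-c u∈ wt-u ui ci cj uj
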